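{- Let $k$ be a non-perfect field of characteristic $p>0$ and $G$ a unipotent algebraic $k$-group. If $G$ is of Rosenlicht type, then $\dim G$ is divisible by $p-1$.
   Context: A $p$-polynomial over $k$ is a $k$-linear combination of monomials $T_i^{p^j}$; its principal part is $\sum_i c_iT_i^{p^{m_i}}$, $p^{m_i}$ the highest degree of $T_i$ and $c_i\ne0$ its coefficient; it is separable if some $T_i$ occurs linearly with nonzero coefficient. A separable $p$-polynomial $P(T_1,\dots,T_{d+1})$ is of Rosenlicht type if its principal part vanishes nowhere on $k^{d+1}\setminus\{0\}$ and, after reindexing, $P_{\mathrm{princ}}=\sum_{i=1}^{r_1}c_iT_i^{p^M}+\sum_{i=r_1+1}^{r_1+r_2}c_iT_i^{p^{M-1}}+\cdots+\sum_{i=r_1+\cdots+r_{M-1}+1}^{r_1+\cdots+r_M}c_iT_i^{p}$ with $M\ge1$, $r_1\ge1$, $r_j\ge0$, $\sum r_j=d+1$, $\sum_j p^{j-1}r_j=p^M$. A unipotent $k$-group of dimension $d$ is of Rosenlicht type if it is $k$-isomorphic to the $k$-subgroup of $\mathbb{G}_a^{d+1}$ which is the kernel of such a polynomial. -}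

module Defs where

open import Level using (Level; _⊔_)
open import Data.Nat as ℕ using (ℕ; zero; suc; _∸_; _≤_; _<_)
open import Data.Nat.Primality using (Prime)
open import Data.Fin using (Fin) renaming (zero to fzero; suc to fsuc)
open import Data.List using (List; length; filter)
open import Data.List using () renaming (allFin to allFinL)
open import Data.Product using (Σ; ∃; _×_; _,_)
open import Relation.Nullary using (¬_)
open import Relation.Binary.PropositionalEquality using (_≡_)
open import Algebra.Bundles using (CommutativeRing)

record Field (c ℓ : Level) : Set (Level.suc (c ⊔ ℓ)) where
  field
    commRing : CommutativeRing c ℓ
  open CommutativeRing commRing public
  field
    1≉0     : ¬ (1# ≈ 0#)
    inverse : ∀ x → ¬ (x ≈ 0#) → Σ Carrier λ y → x * y ≈ 1#

module _ {c ℓ : Level} (k : Field c ℓ) where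
  open Field k

  pow : Carrier → ℕ → Carrier
  pow x zero    = 1#
  pow x (suc n) = x * pow x n

  natCast : ℕ → Carrier
  natCast zero    = 0#
  natCast (suc n) = 1# + natCast n

  sumF : ∀ n → (Fin n → Carrier) → Carrier
  sumF zero    f = 0#
  sumF (suc n) f = f fzero + sumF n (λ i → f (fsuc i))

  HasChar : ℕ → Set ℓ
  HasChar p = natCast p ≈ 0#

  NonPerfect : ℕ → Set (c ⊔ ℓ)
  NonPerfect p = Σ Carrier λ a → ∀ b → ¬ (pow b p ≈ a)

  -- A p-polynomial in n variables T_0,…,T_{n-1}:
  --   P = Σ_i Σ_j coeff i j · T_i^{p^j},  with finitely many nonzero coefficients
  -- (finiteness is recorded by a bound: coeff i j = 0 for j > bound).
  record PPoly (n : ℕ) : Set (c ⊔ ℓ) where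
    field
      coeff : Fin n → ℕ → Carrier
      bound : ℕ
      finite : ∀ i j → bound < j → coeff i j ≈ 0#

  module _ {n : ℕ} (P : PPoly n) where
    open PPoly P

    Separable : Set ℓ
    Separable = Σ (Fin n) λ i → ¬ (coeff i 0 ≈ 0#)

    IsTopExp : (Fin n → ℕ) → Set ℓ
    IsTopExp m = ∀ i → ¬ (coeff i (m i) ≈ 0#) × (∀ j → m i < j → coeff i j ≈ 0#)

    principalEval : ℕ → (Fin n → ℕ) → (Fin n → Carrier) → Carrier
    principalEval p m x = sumF n (λ i → coeff i (m i) * pow (x i) (p ℕ.^ m i))

  rCount : ∀ {n} → (Fin n → ℕ) → ℕ → ℕ → ℕ
  rCount {n} m M j = length (filter (λ i → m i ℕ.≟ (suc M ∸ j)) (allFinL n))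

  sumFrom1 : ℕ → (ℕ → ℕ) → ℕ
  sumFrom1 zero    f = 0
  sumFrom1 (suc M) f = sumFrom1 M f ℕ.+ f (suc M)

  RosenlichtType : (p d : ℕ) → PPoly (suc d) → Set (c ⊔ ℓ)
  RosenlichtType p d P =
    Separable P ×
    Σ (Fin (suc d) → ℕ) λ m → IsTopExp P m ×
    (∀ (x : Fin (suc d) → Carrier) → Σ (Fin (suc d)) (λ i → ¬ (x i ≈ 0#)) →
       ¬ (principalEval P p m x ≈ 0#)) ×
    Σ ℕ λ M → 1 ≤ M ×
      (∀ i → 1 ≤ m i × m i ≤ M) ×
      1 ≤ rCount m M 1 ×
      sumFrom1 M (rCount m M) ≡ suc d ×
      sumFrom1 M (λ j → p ℕ.^ (j ∸ 1) ℕ.* rCount m M j) ≡ p ℕ.^ M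

  -- A unipotent k-group of dimension d of Rosenlicht type is, by definition, (isomorphic to)
  -- the kernel in G_a^{d+1} of such a polynomial; we record it by that polynomial.
  record RosenlichtGroup (p d : ℕ) : Set (c ⊔ ℓ) where
    field
      poly : PPoly (suc d)
      isRosenlicht : RosenlichtType p d poly

  dimR : ∀ {p d} → RosenlichtGroup p d → ℕ
  dimR {d = d} _ = d

module Submission where

-- The dimension of a Rosenlicht-type group is forced by a congruence modulo p - 1.
-- Writing r_j for the number of variables whose principal exponent is p^(M+1-j),
-- the defining conditions give
--     Σ_{j=1}^{M} r_j = d + 1     and     Σ_{j=1}^{M} p^(j-1) r_j = p^M.
-- Since p ≡ 1 (mod p - 1), every power p^e is ≡ 1, so the second sum is ≡ to the
-- first one; hence d + 1 ≡ p^M ≡ 1, i.e. (p - 1) ∣ d.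
--
-- The corollary combines these.

open import Defs
open import Level using (Level)
open import Data.Nat using (ℕ; _∸_; zero; suc; pred; _+_; _*_; _^_)
open import Data.Nat.Primality using (Prime; ¬prime[0])
open import Data.Nat.Divisibility using (_∣_; ∣m+n∣m⇒∣n; m∣m*n)
open import Data.Product using (Σ; _×_; _,_)
open import Data.Fin using (Fin)
open import Data.Empty using (⊥-elim)
open import Relation.Binary.PropositionalEquality using (_≡_; refl; sym; cong; cong₂; subst; module ≡-Reasoning)
open import Data.Nat.Solver using (module +-*-Solver)
open +-*-Solver using (solve; _:+_; _:*_; _:=_; con)

pow-≡1 : ∀ a n → Σ ℕ λ q → suc a ^ n ≡ 1 + a * q
pow-≡1 a zero = 0 , solve 1 (λ a → con 1 := con 1 :+ a :* con 0) refl a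
pow-≡1 a (suc n) with pow-≡1 a n
... | q , eq = suc (q + a * q) , (begin
  suc a * suc a ^ n        ≡⟨ cong (suc a *_) eq ⟩
  suc a * (1 + a * q)      ≡⟨ solve 2 (λ a q → (con 1 :+ a) :* (con 1 :+ a :* q)
                                        := con 1 :+ a :* (con 1 :+ (q :+ a :* q))) refl a q ⟩
  1 + a * suc (q + a * q)  ∎)
  where open ≡-Reasoning

∣-of-congruent : ∀ a x q q′ → x + a * q ≡ a * q′ → a ∣ x
∣-of-congruent a x q q′ eq =
  ∣m+n∣m⇒∣n {m = a * q} (subst (a ∣_) (sym eq′) (m∣m*n q′)) (m∣m*n q)
  where
  open ≡-Reasoning
  eq′ : a * q + x ≡ a * q′
  eq′ = begin
    a * q + x  ≡⟨ solve 2 (λ u x → u :+ x := x :+ u) refl (a * q) x ⟩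
    x + a * q  ≡⟨ eq ⟩
    a * q′     ∎

module _ {c ℓ : Level} (k : Field c ℓ) where

  weighted-≡ : ∀ a M (f : ℕ → ℕ) → Σ ℕ λ q →
    sumFrom1 k M (λ j → suc a ^ (j ∸ 1) * f j) ≡ sumFrom1 k M f + a * q
  weighted-≡ a zero f = 0 , solve 1 (λ a → con 0 := con 0 :+ a :* con 0) refl a
  weighted-≡ a (suc M) f with weighted-≡ a M f | pow-≡1 a M
  ... | q , eq | q₁ , eq₁ = q + q₁ * f (suc M) , (begin
    sumFrom1 k M (λ j → suc a ^ (j ∸ 1) * f j) + suc a ^ M * f (suc M)
      ≡⟨ cong₂ (λ x y → x + y * F) eq eq₁ ⟩
    (S + a * q) + (1 + a * q₁) * F
      ≡⟨ solve 5 (λ S a q q₁ F → S :+ a :* q :+ (con 1 :+ a :* q₁) :* F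
                               := S :+ F :+ a :* (q :+ q₁ :* F)) refl S a q q₁ F ⟩
    S + F + a * (q + q₁ * F)
      ∎)
    where
    open ≡-Reasoning
    S = sumFrom1 k M f
    F = f (suc M)

  rosenlicht-counts : ∀ {p d} (P : PPoly k (suc d)) → RosenlichtType k p d P →
    Σ (Fin (suc d) → ℕ) λ m → Σ ℕ λ M →
      sumFrom1 k M (rCount k m M) ≡ suc d ×
      sumFrom1 k M (λ j → p ^ (j ∸ 1) * rCount k m M j) ≡ p ^ M
  rosenlicht-counts P (_ , m , _ , _ , M , _ , _ , _ , count , weightedCount) =
    m , M , count , weightedCount

corollary11 : ∀ {c ℓ : Level} (k : Field c ℓ) (p : ℕ) → Prime p → HasChar k p → NonPerfect k p →
    ∀ (d : ℕ) (G : RosenlichtGroup k p d) → (p ∸ 1) ∣ dimR k G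
corollary11 k zero p-prime _ _ d G = ⊥-elim (¬prime[0] p-prime)
corollary11 k (suc a) _ _ _ d G
  with rosenlicht-counts k (RosenlichtGroup.poly G) (RosenlichtGroup.isRosenlicht G)
... | m , M , count , weightedCount
  with weighted-≡ k a M (rCount k m M) | pow-≡1 a M
... | q , weighted | q′ , power = ∣-of-congruent a d q q′ (cong pred (begin
    suc d + a * q                                         ≡⟨ cong (_+ a * q) (sym count) ⟩
    sumFrom1 k M (rCount k m M) + a * q                    ≡⟨ sym weighted ⟩
    sumFrom1 k M (λ j → suc a ^ (j ∸ 1) * rCount k m M j)  ≡⟨ weightedCount ⟩
    suc a ^ M                                             ≡⟨ power ⟩
    suc (a * q′)                                          ∎))
  where open ≡-Reasoning
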